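{- Let $k\ge1$, $r\ge2$ be integers and $H=H^{(k,r)}$. If $F$ is a monotone algebraic formula computing $H$ and $\alpha$ is a gate of $F$ computing a polynomial of degree $d_\alpha$, then the polynomial computed at $\alpha$ has at most $r^{d_\alpha-1}$ monomials.
   Context: For integers $k\ge1$, $r\ge2$, the polynomial $H^{(k,r)}$ is defined over the $(2r)^k$ variables $\{x_{\sigma,\tau}: \sigma\in[2]^k,\ \tau\in[r]^k\}$ as follows. For words $u\in[2]^{\le k}$, $v\in[r]^{\le k}$ with $|u|=|v|$, define recursively $H_{u,v}=x_{u,v}$ if $|u|=|v|=k$, and otherwise $H_{u,v}=\sum_{a=1}^{r}H_{u1,va}\,H_{u2,va}$. Then $H^{(k,r)}=H_{\varepsilon,\varepsilon}$ ($\varepsilon$ the empty word); it has degree $2^k$ and $r^{2^k-1}$ monomials. An algebraic formula is a rooted tree with edges directed towards the root; leaves are labelled by variables or the constant $1$, edges by non-zero field constants, internal nodes by $+$ (linear combination with edge weights) or $\times$ (product), with unbounded fan-in; no gate computes the zero polynomial. A parse tree is defined inductively: at a $+$-gate take a parse tree of one child (with the edge), at a $\times$-gate a parse tree of each child (with the edges), a leaf is its own parse tree; it computes the product of its leaf labels and edge constants, and the formula computes the sum over all parse trees. A formula is monotone if every monomial computed by one of its parse trees has non-zero coefficient in the polynomial computed by the formula. -}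

module Defs where

open import Level using (Level; _⊔_) renaming (suc to lsuc)
open import Algebra.Bundles using (CommutativeRing)
open import Data.Nat using (ℕ; zero; suc; _+_; _≤_)
open import Data.Fin using (Fin) renaming (zero to f0; suc to fs)
import Data.Fin.Properties as FinP
open import Data.Vec using (Vec; []; _∷_)
import Data.Vec.Properties as VecP
open import Data.List using (List; []; _∷_; _++_; map; length; allFin; concatMap)
open import Data.Nat.ListAction using (sum)
open import Data.List.Membership.Propositional using (_∈_)
open import Data.List.Relation.Unary.All using (All)
open import Data.List.Relation.Unary.AllPairs using (AllPairs)
open import Data.Product using (_×_; _,_; proj₁; proj₂; ∃; Σ)
open import Data.Product.Properties using (≡-dec)
open import Data.Unit using (⊤)
open import Relation.Nullary using (¬_; Dec; yes; no; map′)
open import Relation.Nullary.Decidable using (_×-dec_)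
open import Relation.Binary.PropositionalEquality using (_≡_; refl)

record Field (c ℓ : Level) : Set (lsuc (c ⊔ ℓ)) where
  field
    commutativeRing : CommutativeRing c ℓ
  open CommutativeRing commutativeRing public
  field
    1≉0     : ¬ (1# ≈ 0#)
    inverse : ∀ x → ¬ (x ≈ 0#) → ∃ λ y → (x * y) ≈ 1#

sumWords : ∀ {n} k → (Vec (Fin n) k → ℕ) → ℕ
sumWords {n} zero    f = f []
sumWords {n} (suc k) f = sum (map (λ i → sumWords k (λ w → f (i ∷ w))) (allFin n))

allWords? : ∀ {p n} k {P : Vec (Fin n) k → Set p} →
            (∀ w → Dec (P w)) → Dec (∀ w → P w)
allWords? zero    P? = map′ (λ { p [] → p }) (λ h → h []) (P? [])
allWords? {n = n} (suc k) {P} P? =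
  map′ (λ h → λ { (i ∷ w) → h i w }) (λ h i w → h (i ∷ w))
       (FinP.all? (λ i → allWords? k (λ w → P? (i ∷ w))))

module Poly {c ℓ : Level} (𝔽 : Field c ℓ) (k r : ℕ) where
  open Field 𝔽 renaming (Carrier to K; _+_ to _+K_; _*_ to _*K_)

  Var : Set
  Var = Vec (Fin 2) k × Vec (Fin r) k

  _≟v_ : (x y : Var) → Dec (x ≡ y)
  _≟v_ = ≡-dec (VecP.≡-dec FinP._≟_) (VecP.≡-dec FinP._≟_)

  Mon : Set
  Mon = Var → ℕ

  _≈m_ : Mon → Mon → Set
  m ≈m m′ = ∀ x → m x ≡ m′ x

  _≈m?_ : (m m′ : Mon) → Dec (m ≈m m′)
  m ≈m? m′ =
    map′ (λ h → λ { (σ , τ) → h σ τ }) (λ h σ τ → h (σ , τ))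
         (allWords? k (λ σ → allWords? k (λ τ → Data.Nat._≟_ (m (σ , τ)) (m′ (σ , τ)))))
    where import Data.Nat

  unitMon : Mon
  unitMon _ = 0

  varMon : Var → Mon
  varMon x y with x ≟v y
  ... | yes _ = 1
  ... | no  _ = 0

  _·m_ : Mon → Mon → Mon
  (m ·m m′) x = m x + m′ x

  degMon : Mon → ℕ
  degMon m = sumWords k (λ σ → sumWords k (λ τ → m (σ , τ)))

  -- Algebraic formulas: leaves are variables or the constant 1; internal
  -- nodes are + or × gates whose children are listed together with the
  -- constant labelling the edge from the child.
  data Formula : Set c where
    var   : Var → Formula
    one   : Formula
    plus  : List (K × Formula) → Formula
    times : List (K × Formula) → Formula

  -- The list of parse trees of a formula, each represented by the
  -- (coefficient, monomial) it computes (product of edge constants,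
  -- product of leaf labels).
  Term : Set c
  Term = K × Mon

  mutual
    parseTrees : Formula → List Term
    parseTrees (var x)    = (1# , varMon x) ∷ []
    parseTrees one        = (1# , unitMon) ∷ []
    parseTrees (plus es)  = plusPT es
    parseTrees (times es) = timesPT es

    plusPT : List (K × Formula) → List Term
    plusPT []             = []
    plusPT ((a , g) ∷ es) =
      map (λ t → (a *K proj₁ t , proj₂ t)) (parseTrees g) ++ plusPT es

    timesPT : List (K × Formula) → List Term
    timesPT []             = (1# , unitMon) ∷ []
    timesPT ((a , g) ∷ es) =
      concatMap (λ t → map (λ u → ((a *K proj₁ t) *K proj₁ u , proj₂ t ·m proj₂ u))
                           (timesPT es))
                (parseTrees g)

  coeffL : List Term → Mon → K
  coeffL []             m = 0#
  coeffL ((a , m′) ∷ ts) m with m′ ≈m? m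
  ... | yes _ = a +K coeffL ts m
  ... | no  _ = coeffL ts m

  coeff : Formula → Mon → K
  coeff Φ = coeffL (parseTrees Φ)

  _computesSameAs_ : Formula → Formula → Set ℓ
  Φ computesSameAs Ψ = ∀ m → coeff Φ m ≈ coeff Ψ m

  data _⊑_ (α : Formula) : Formula → Set c where
    here    : α ⊑ α
    inPlus  : ∀ {es a g} → (a , g) ∈ es → α ⊑ g → α ⊑ plus es
    inTimes : ∀ {es a g} → (a , g) ∈ es → α ⊑ g → α ⊑ times es

  NonZeroPoly : Formula → Set ℓ
  NonZeroPoly α = ∃ λ m → ¬ (coeff α m ≈ 0#)

  LocalOK : Formula → Set (c ⊔ ℓ)
  LocalOK (var x)    = Level.Lift _ ⊤
  LocalOK one        = Level.Lift _ ⊤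
  LocalOK (plus es)  = (1 ≤ length es) × All (λ e → ¬ (proj₁ e ≈ 0#)) es
  LocalOK (times es) = (1 ≤ length es) × All (λ e → ¬ (proj₁ e ≈ 0#)) es

  IsFormula : Formula → Set (c ⊔ ℓ)
  IsFormula Φ = ∀ α → α ⊑ Φ → LocalOK α × NonZeroPoly α

  Monotone : Formula → Set (c ⊔ ℓ)
  Monotone Φ = All (λ t → ¬ (coeff Φ (proj₂ t) ≈ 0#)) (parseTrees Φ)

  HasDegree : Formula → ℕ → Set ℓ
  HasDegree α d = (∃ λ m → ¬ (coeff α m ≈ 0#) × degMon m ≡ d)
                × (∀ m → ¬ (coeff α m ≈ 0#) → degMon m ≤ d)

  AtMostMonomials : Formula → ℕ → Set ℓ
  AtMostMonomials α B =
    ∀ (ms : List Mon) → AllPairs (λ m m′ → ¬ (m ≈m m′)) ms →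
    All (λ m → ¬ (coeff α m ≈ 0#)) ms → length ms ≤ B

  -- Hrec j f is H_{u,v} with |u| = |v| = k - j, where
  -- f σ τ = x_{uσ, vτ} for the remaining suffixes σ, τ of length j.
  Hrec : (j : ℕ) → (Vec (Fin 2) j → Vec (Fin r) j → Var) → Formula
  Hrec zero    f = var (f [] [])
  Hrec (suc j) f =
    plus (map (λ a → (1# , times ( (1# , Hrec j (λ σ τ → f (f0 ∷ σ) (a ∷ τ)))
                                 ∷ (1# , Hrec j (λ σ τ → f (fs f0 ∷ σ) (a ∷ τ)))
                                 ∷ [])))
              (allFin r))

  H : Formula
  H = Hrec k (λ σ τ → (σ , τ))

-- Every parse tree of α extends to a parse tree of Φ by
-- one fixed choice of parse trees for the rest of Φ, so there is a monomial C
-- such that m · C is the monomial of a parse tree of Φ for every monomial m of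
-- α.  By monotonicity m · C is then a monomial of H, i.e. the monomial of a
-- labelling L of the complete binary tree of depth k by [r] at its inner
-- nodes.  If C divides mon(L), the label of every inner node whose subtree
-- meets the support of C is forced; the remaining nodes form complete subtrees
-- that C does not meet, and such a subtree with 2^j leaves contributes 2^j to
-- the degree of m = mon(L)/C but only 2^j − 1 free labels.  Hence m takes at
-- most r^(deg m − 1) values.

module Submission where

open import Defs
open import Level using (Level)
open import Data.Nat
  using (ℕ; zero; suc; _+_; _*_; _≤_; _<_; _^_; _∸_; z≤n; s≤s; NonZero; >-nonZero; _≤?_)
open import Data.Nat.Properties
open import Algebra.Properties.CommutativeSemigroup +-commutativeSemigroup
  using (interchange; x∙yz≈y∙xz)
open import Data.Nat.ListAction using (sum)
open import Data.Fin as Fin using (Fin) renaming (zero to f0; suc to fs)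
import Data.Fin.Properties as Finₚ
open import Data.Vec using (Vec; []; _∷_)
import Data.Vec.Properties as Vecₚ
open import Data.List
  using (List; []; _∷_; map; length; allFin; lookup; cartesianProduct; cartesianProductWith)
import Data.List.Properties as Listₚ
open import Data.List.Membership.Propositional using (_∈_; find; lose)
open import Data.List.Membership.Propositional.Properties
  using (∈-map⁺; ∈-map⁻; ∈-allFin; ∈-lookup; ∈-cartesianProductWith⁺; ∈-cartesianProduct⁺)
import Data.List.Membership.Setoid as SetoidMembership
import Data.List.Membership.Setoid.Properties as SetoidMembershipₚ
open import Data.List.Relation.Unary.All as All using (All; []; _∷_)
open import Data.List.Relation.Unary.Any as Any using (Any; here; there)
import Data.List.Relation.Unary.Any.Properties as Anyₚ
open import Data.List.Relation.Unary.AllPairs using ([]; _∷_)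
import Data.List.Relation.Unary.Unique.Setoid as UniqueSetoid
open import Data.Product using (_×_; _,_; proj₁; proj₂; ∃; ∃₂; uncurry)
open import Data.Sum using (_⊎_; inj₁; inj₂)
open import Function using (_∘_; id)
open import Relation.Binary.Bundles using (Setoid)
open import Relation.Nullary using (¬_; Dec; yes; no; contradiction)
open import Relation.Nullary.Decidable using (¬?)
open import Relation.Binary.PropositionalEquality
  using (_≡_; _≢_; refl; sym; trans; cong; cong₂; _→-setoid_; module ≡-Reasoning)

module _ {a ℓ} (S : Setoid a ℓ) where
  open Setoid S using (_≉_)
  open SetoidMembership S using () renaming (_∈_ to _∈ₛ_)
  open UniqueSetoid S using (Unique)

  Unique-lookup : ∀ {xs} → Unique xs → ∀ {i j} → i Fin.< j → lookup xs i ≉ lookup xs j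
  Unique-lookup (x≉xs ∷ _) {f0}   {fs j} _         = All.lookup x≉xs (∈-lookup j)
  Unique-lookup (_ ∷ u)    {fs i} {fs j} (s≤s i<j) = Unique-lookup u i<j

  Unique⇒length≤ : ∀ {xs ys} → Unique xs → All (_∈ₛ ys) xs → length xs ≤ length ys
  Unique⇒length≤ {xs} {ys} u xs⊆ys with length xs ≤? length ys
  ... | yes xs≤ys = xs≤ys
  ... | no xs≰ys =
    let i , j , i<j , same-index =
          Finₚ.pigeonhole (≰⇒> xs≰ys) (λ i → Any.index (All.lookup xs⊆ys (∈-lookup i)))
    in contradiction (SetoidMembershipₚ.index-injective S _ _ same-index) (Unique-lookup u i<j)

sum-map-+ : ∀ {A : Set} (f g : A → ℕ) xs →
            sum (map (λ x → f x + g x) xs) ≡ sum (map f xs) + sum (map g xs)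
sum-map-+ f g []       = refl
sum-map-+ f g (x ∷ xs) =
  trans (cong (f x + g x +_) (sum-map-+ f g xs)) (interchange (f x) (g x) _ _)

length-cartesianProductWith : ∀ {A B C : Set} (f : A → B → C) xs ys →
  length (cartesianProductWith f xs ys) ≡ length xs * length ys
length-cartesianProductWith f []       ys = refl
length-cartesianProductWith f (x ∷ xs) ys =
  trans (Listₚ.length-++ (map (f x) ys))
        (cong₂ _+_ (Listₚ.length-map (f x) ys) (length-cartesianProductWith f xs ys))

∈⇒≤sum : ∀ {x xs} → x ∈ xs → x ≤ sum xs
∈⇒≤sum {xs = _ ∷ xs} (here refl) = m≤m+n _ (sum xs)
∈⇒≤sum {xs = y ∷ _}  (there x∈) = ≤-trans (∈⇒≤sum x∈) (m≤n+m _ y)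

[m+n]∸o≡[m∸o]+[n∸o] : ∀ {m n} o → m ≡ 0 ⊎ n ≡ 0 → (m + n) ∸ o ≡ (m ∸ o) + (n ∸ o)
[m+n]∸o≡[m∸o]+[n∸o] {n = n} o (inj₁ refl) = cong (_+ (n ∸ o)) (sym (0∸n≡0 o))
[m+n]∸o≡[m∸o]+[n∸o] {m}     o (inj₂ refl) = begin
  (m + 0) ∸ o        ≡⟨ cong (_∸ o) (+-identityʳ m) ⟩
  m ∸ o              ≡⟨ +-identityʳ (m ∸ o) ⟨
  (m ∸ o) + 0        ≡⟨ cong ((m ∸ o) +_) (0∸n≡0 o) ⟨
  (m ∸ o) + (0 ∸ o)  ∎
  where open ≡-Reasoning

[m∸1]+[n∸1]≤m+n∸1 : ∀ m n → (m ∸ 1) + (n ∸ 1) ≤ (m + n) ∸ 1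
[m∸1]+[n∸1]≤m+n∸1 zero    n = ≤-refl
[m∸1]+[n∸1]≤m+n∸1 (suc m) n = +-monoʳ-≤ m (m∸n≤m n 1)

^[m∸1]*^[n∸1]≤^[m+n∸1] : ∀ r .⦃ _ : NonZero r ⦄ m n → r ^ (m ∸ 1) * r ^ (n ∸ 1) ≤ r ^ (m + n ∸ 1)
^[m∸1]*^[n∸1]≤^[m+n∸1] r m n =
  ≤-trans (≤-reflexive (sym (^-distribˡ-+-* r (m ∸ 1) (n ∸ 1))))
          (^-monoʳ-≤ r ([m∸1]+[n∸1]≤m+n∸1 m n))

module _ {n : ℕ} where

  sumWords-cong : ∀ k {f g : Vec (Fin n) k → ℕ} → (∀ w → f w ≡ g w) → sumWords k f ≡ sumWords k g
  sumWords-cong zero    f≗g = f≗g []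
  sumWords-cong (suc k) f≗g =
    cong sum (Listₚ.map-cong (λ i → sumWords-cong k (λ w → f≗g (i ∷ w))) (allFin n))

  sumWords-+ : ∀ k (f g : Vec (Fin n) k → ℕ) →
               sumWords k (λ w → f w + g w) ≡ sumWords k f + sumWords k g
  sumWords-+ zero    f g = refl
  sumWords-+ (suc k) f g =
    trans (cong sum (Listₚ.map-cong (λ i → sumWords-+ k _ _) (allFin n))) (sum-map-+ _ _ (allFin n))

  ≤-sumWords : ∀ k (f : Vec (Fin n) k → ℕ) w → f w ≤ sumWords k f
  ≤-sumWords zero    f []      = ≤-refl
  ≤-sumWords (suc k) f (i ∷ w) =
    ≤-trans (≤-sumWords k (λ w → f (i ∷ w)) w) (∈⇒≤sum (∈-map⁺ _ (∈-allFin i)))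

module GateMonomials {c ℓ : Level} (𝔽 : Field c ℓ) (k r : ℕ) where
  open Poly 𝔽 k r
  open Field 𝔽 using (_≈_; 0#; 1#) renaming (refl to ≈-refl; trans to ≈-trans)

  Mon-setoid : Setoid _ _
  Mon-setoid = Var →-setoid ℕ

  open Setoid Mon-setoid using () renaming (refl to ≈m-refl; sym to ≈m-sym; trans to ≈m-trans)

  _∸m_ : Mon → Mon → Mon
  (m ∸m m′) x = m x ∸ m′ x

  ·m-cong : ∀ {m₁ m₂ m₁′ m₂′} → m₁ ≈m m₁′ → m₂ ≈m m₂′ → (m₁ ·m m₂) ≈m (m₁′ ·m m₂′)
  ·m-cong eq₁ eq₂ x = cong₂ _+_ (eq₁ x) (eq₂ x)

  ·m-identityʳ : ∀ m → (m ·m unitMon) ≈m m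
  ·m-identityʳ m x = +-identityʳ (m x)

  ·m-assoc : ∀ m₁ m₂ m₃ → ((m₁ ·m m₂) ·m m₃) ≈m (m₁ ·m (m₂ ·m m₃))
  ·m-assoc m₁ m₂ m₃ x = +-assoc (m₁ x) (m₂ x) (m₃ x)

  ·m-leftComm : ∀ m₁ m₂ m₃ → (m₁ ·m (m₂ ·m m₃)) ≈m (m₂ ·m (m₁ ·m m₃))
  ·m-leftComm m₁ m₂ m₃ x = x∙yz≈y∙xz (m₁ x) (m₂ x) (m₃ x)

  quotient-≈ : ∀ {n} m C → n ≈m (m ·m C) → m ≈m (n ∸m C)
  quotient-≈ m C n≈mC x = sym (trans (cong (_∸ C x) (n≈mC x)) (m+n∸n≡m (m x) (C x)))

  degMon-cong : ∀ {m m′} → m ≈m m′ → degMon m ≡ degMon m′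
  degMon-cong m≈m′ = sumWords-cong k (λ σ → sumWords-cong k (λ τ → m≈m′ (σ , τ)))

  degMon-·m : ∀ m m′ → degMon (m ·m m′) ≡ degMon m + degMon m′
  degMon-·m m m′ = trans (sumWords-cong k (λ σ → sumWords-+ k _ _)) (sumWords-+ k _ _)

  ≤-degMon : ∀ m x → m x ≤ degMon m
  ≤-degMon m (σ , τ) = ≤-trans (≤-sumWords k _ τ) (≤-sumWords k _ σ)

  varMon-self : ∀ x → varMon x x ≡ 1
  varMon-self x with x ≟v x
  ... | yes _ = refl
  ... | no x≢x = contradiction refl x≢x

  record Produces (Φ : Formula) (m : Mon) : Set c where
    constructor produces
    field parse : Any (λ t → proj₂ t ≈m m) (parseTrees Φ)

  Produces-resp : ∀ {Φ m m′} → m ≈m m′ → Produces Φ m → Produces Φ m′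
  Produces-resp m≈m′ (produces p) = produces (Any.map (λ t≈m → ≈m-trans t≈m m≈m′) p)

  coeffL≉0⇒Any : ∀ ts {m} → ¬ (coeffL ts m ≈ 0#) → Any (λ t → proj₂ t ≈m m) ts
  coeffL≉0⇒Any []              c≉0 = contradiction ≈-refl c≉0
  coeffL≉0⇒Any ((a , m′) ∷ ts) {m} c≉0 with m′ ≈m? m
  ... | yes m′≈m = here m′≈m
  ... | no _     = there (coeffL≉0⇒Any ts c≉0)

  coeff≉0⇒Produces : ∀ Φ {m} → ¬ (coeff Φ m ≈ 0#) → Produces Φ m
  coeff≉0⇒Produces Φ c≉0 = produces (coeffL≉0⇒Any (parseTrees Φ) c≉0)

  Produces-plus⁺ : ∀ {es a g m} → (a , g) ∈ es → Produces g m → Produces (plus es) m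
  Produces-plus⁺ (here refl) (produces p) = produces (Anyₚ.++⁺ˡ (Anyₚ.map⁺ p))
  Produces-plus⁺ {(b , h) ∷ _} (there e∈es) p =
    produces (Anyₚ.++⁺ʳ (map _ (parseTrees h)) (Produces.parse (Produces-plus⁺ e∈es p)))

  Produces-plus⁻ : ∀ {es m} → Produces (plus es) m → ∃ λ e → e ∈ es × Produces (proj₂ e) m
  Produces-plus⁻ {(b , h) ∷ es} (produces p) with Anyₚ.++⁻ (map _ (parseTrees h)) p
  ... | inj₁ q = (b , h) , here refl , produces (Anyₚ.map⁻ q)
  ... | inj₂ q = let e , e∈es , q′ = Produces-plus⁻ (produces q) in e , there e∈es , q′

  Produces-times⁺ : ∀ {es a g m m′} → Produces g m → Produces (times es) m′ →
                    Produces (times ((a , g) ∷ es)) (m ·m m′)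
  Produces-times⁺ (produces p) (produces q) =
    produces (Anyₚ.concatMap⁺ _ (Any.map (λ t≈m → Anyₚ.map⁺ (Any.map (·m-cong t≈m) q)) p))

  Produces-times⁻ : ∀ {es a g m} → Produces (times ((a , g) ∷ es)) m →
                    ∃₂ λ m₁ m₂ → Produces g m₁ × Produces (times es) m₂ × (m₁ ·m m₂) ≈m m
  Produces-times⁻ (produces p) =
    let t , t∈ , q = find (Anyₚ.concatMap⁻ _ p)
        u , u∈ , tu≈m = find (Anyₚ.map⁻ q)
    in proj₂ t , proj₂ u , produces (lose t∈ ≈m-refl) , produces (lose u∈ ≈m-refl) , tu≈m

  times-produces : ∀ {es} → (∀ {b h} → (b , h) ∈ es → ∃ (Produces h)) → ∃ (Produces (times es))
  times-produces {[]}    _      = unitMon , produces (here ≈m-refl)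
  times-produces {_ ∷ _} parsed =
    let _ , p = parsed (here refl); _ , q = times-produces (parsed ∘ there)
    in _ , Produces-times⁺ p q

  times-factor : ∀ {es a g} → (a , g) ∈ es → (∀ {b h} → (b , h) ∈ es → ∃ (Produces h)) →
                 ∃ λ D → ∀ {m} → Produces g m → Produces (times es) (m ·m D)
  times-factor (here refl) parsed =
    let D , pD = times-produces (parsed ∘ there) in D , λ p → Produces-times⁺ p pD
  times-factor (there e∈es) parsed =
    let n , pn = parsed (here refl); D , factor = times-factor e∈es (parsed ∘ there)
    in n ·m D , λ {m} p → Produces-resp (·m-leftComm n m D) (Produces-times⁺ pn (factor p))

  gate-produces : ∀ {Φ β} → IsFormula Φ → β ⊑ Φ → ∃ (Produces β)
  gate-produces {β = β} isF β⊑Φ =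
    let m , c≉0 = proj₂ (isF β β⊑Φ) in m , coeff≉0⇒Produces β c≉0

  gate-context : ∀ {Φ α} → IsFormula Φ → α ⊑ Φ →
                 ∃ λ C → ∀ {m} → Produces α m → Produces Φ (m ·m C)
  gate-context isF here = unitMon , Produces-resp (≈m-sym (·m-identityʳ _))
  gate-context isF (inPlus e∈es α⊑g) =
    let C , extend = gate-context (λ β β⊑g → isF β (inPlus e∈es β⊑g)) α⊑g
    in C , Produces-plus⁺ e∈es ∘ extend
  gate-context isF (inTimes e∈es α⊑g) =
    let C , extend = gate-context (λ β β⊑g → isF β (inTimes e∈es β⊑g)) α⊑g
        D , factor = times-factor e∈es (λ e′∈es → gate-produces isF (inTimes e′∈es here))
    in C ·m D , λ {m} p → Produces-resp (·m-assoc m C D) (factor (extend p))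

  monotone-Produces : ∀ {Φ m} → Monotone Φ → Φ computesSameAs H → Produces Φ m → Produces H m
  monotone-Produces mono same (produces p) =
    let t , t∈ , t≈m = find p
        coeffH≉0 = λ coeffH≈0 → All.lookup mono t∈ (≈-trans (same (proj₂ t)) coeffH≈0)
    in Produces-resp t≈m (coeff≉0⇒Produces H coeffH≉0)

  -- A labelling of depth j chooses the summand a ∈ [r] at every +-gate of
  -- Hrec j f; the address f tells where the variables of that subformula sit.
  data Labelling : ℕ → Set where
    leaf : Labelling zero
    node : ∀ {j} → Fin r → Labelling j → Labelling j → Labelling (suc j)

  Address : ℕ → Set
  Address j = Vec (Fin 2) j → Vec (Fin r) j → Var

  child : ∀ {j} → Address (suc j) → Fin 2 → Fin r → Address j
  child f i a σ τ = f (i ∷ σ) (a ∷ τ)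

  monomialOf : ∀ {j} → Address j → Labelling j → Mon
  monomialOf f leaf         = varMon (f [] [])
  monomialOf f (node a L M) = monomialOf (child f f0 a) L ·m monomialOf (child f (fs f0) a) M

  address : Address k
  address σ τ = σ , τ

  summand : ∀ j → Address (suc j) → Fin r → Field.Carrier 𝔽 × Formula
  summand j f a = 1# , times ((1# , Hrec j (child f f0 a)) ∷ (1# , Hrec j (child f (fs f0) a)) ∷ [])

  Hrec-labelling : ∀ j (f : Address j) {m} → Produces (Hrec j f) m → ∃ λ L → monomialOf f L ≈m m
  Hrec-labelling zero    f (produces (here m≈)) = leaf , m≈
  Hrec-labelling (suc j) f p
    with e , e∈ , q ← Produces-plus⁻ p
    with a , _ , refl ← ∈-map⁻ (summand j f) e∈
    with m₀ , m′ , p₀ , q′ , m₀m′≈m ← Produces-times⁻ q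
    with m₁ , _ , p₁ , produces (here unit≈) , m₁u≈m′ ← Produces-times⁻ q′ =
    let L , L≈ = Hrec-labelling j (child f f0 a) p₀
        M , M≈ = Hrec-labelling j (child f (fs f0) a) p₁
        M≈m′ = ≈m-trans M≈ (≈m-trans (≈m-sym (·m-identityʳ m₁))
                                     (≈m-trans (·m-cong ≈m-refl unit≈) m₁u≈m′))
    in node a L M , ≈m-trans (·m-cong L≈ M≈m′) m₀m′≈m

  gate-labellings : ∀ {Φ α} → IsFormula Φ → Monotone Φ → Φ computesSameAs H → α ⊑ Φ →
    ∃ λ C → ∀ {m} → ¬ (coeff α m ≈ 0#) → ∃ λ L → monomialOf address L ≈m (m ·m C)
  gate-labellings {α = α} isF mono same α⊑Φ =
    let C , extend = gate-context isF α⊑Φ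
    in C , λ c≉0 → Hrec-labelling k address
                      (monotone-Produces mono same (extend (coeff≉0⇒Produces α c≉0)))

  Injective : ∀ {j} → Address j → Set
  Injective f = ∀ {σ τ σ′ τ′} → f σ τ ≡ f σ′ τ′ → σ ≡ σ′ × τ ≡ τ′

  address-injective : Injective address
  address-injective refl = refl , refl

  child-injective : ∀ {j} {f : Address (suc j)} {i a} → Injective f → Injective (child f i a)
  child-injective inj eq = let σ≡ , τ≡ = inj eq in Vecₚ.∷-injectiveʳ σ≡ , Vecₚ.∷-injectiveʳ τ≡

  monomialOf-support : ∀ {j} (f : Address j) L {x} → monomialOf f L x ≢ 0 → ∃₂ λ σ τ → f σ τ ≡ x
  monomialOf-support f leaf {x} m≢0 with f [] [] ≟v x
  ... | yes fx≡x = [] , [] , fx≡x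
  ... | no _     = contradiction refl m≢0
  monomialOf-support f (node a L M) {x} m≢0 with monomialOf (child f f0 a) L x ≟ 0
  ... | no  L≢0 = let σ , τ , eq = monomialOf-support _ L L≢0 in f0 ∷ σ , a ∷ τ , eq
  ... | yes L≡0 =
    let σ , τ , eq = monomialOf-support _ M (λ M≡0 → m≢0 (cong₂ _+_ L≡0 M≡0))
    in fs f0 ∷ σ , a ∷ τ , eq

  monomialOf-outside : ∀ {j} (f : Address j) L {x} → (∀ σ τ → f σ τ ≢ x) → monomialOf f L x ≡ 0
  monomialOf-outside f L {x} outside with monomialOf f L x ≟ 0
  ... | yes m≡0 = m≡0
  ... | no  m≢0 = let σ , τ , eq = monomialOf-support f L m≢0 in contradiction eq (outside σ τ)

  monomialOf-other-child : ∀ {j} {f : Address (suc j)} {i i′ a b} L σ τ → Injective f →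
    ¬ (i′ ≡ i × b ≡ a) → monomialOf (child f i′ b) L (f (i ∷ σ) (a ∷ τ)) ≡ 0
  monomialOf-other-child L σ τ inj other =
    monomialOf-outside _ L (λ σ′ τ′ eq →
      let σ≡ , τ≡ = inj eq in other (Vecₚ.∷-injectiveˡ σ≡ , Vecₚ.∷-injectiveˡ τ≡))

  node-∸m : ∀ {j} {f : Address (suc j)} {a} L M C → Injective f →
    (monomialOf f (node a L M) ∸m C) ≈m
      ((monomialOf (child f f0 a) L ∸m C) ·m (monomialOf (child f (fs f0) a) M ∸m C))
  node-∸m {f = f} {a} L M C inj x = [m+n]∸o≡[m∸o]+[n∸o] (C x) one-child-vanishes
    where
    one-child-vanishes : monomialOf (child f f0 a) L x ≡ 0 ⊎ monomialOf (child f (fs f0) a) M x ≡ 0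
    one-child-vanishes with monomialOf (child f f0 a) L x ≟ 0
    ... | yes L≡0 = inj₁ L≡0
    ... | no  L≢0 with σ , τ , refl ← monomialOf-support _ L L≢0 =
      inj₂ (monomialOf-other-child M σ τ inj (Finₚ.0≢1+n ∘ sym ∘ proj₁))

  record _≼⟨_⟩_ {j} (C : Mon) (f : Address j) (m : Mon) : Set where
    constructor dominated
    field ≤-at : ∀ σ τ → C (f σ τ) ≤ m (f σ τ)
  open _≼⟨_⟩_

  divisor-≼ : ∀ {j} (f : Address j) {n} m C → n ≈m (m ·m C) → C ≼⟨ f ⟩ n
  divisor-≼ f m C n≈mC = dominated λ σ τ →
    ≤-trans (m≤n+m (C (f σ τ)) (m (f σ τ))) (≤-reflexive (sym (n≈mC (f σ τ))))

  ≼-child₀ : ∀ {j} {f : Address (suc j)} {a C} L M → Injective f →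
    C ≼⟨ f ⟩ monomialOf f (node a L M) → C ≼⟨ child f f0 a ⟩ monomialOf (child f f0 a) L
  ≼-child₀ L M inj C≼ = dominated λ σ τ →
    ≤-trans (≤-at C≼ (f0 ∷ σ) (_ ∷ τ))
      (≤-reflexive (trans (cong (_ +_) (monomialOf-other-child M σ τ inj
                                          (Finₚ.0≢1+n ∘ sym ∘ proj₁)))
                          (+-identityʳ _)))

  ≼-child₁ : ∀ {j} {f : Address (suc j)} {a C} L M → Injective f →
    C ≼⟨ f ⟩ monomialOf f (node a L M) → C ≼⟨ child f (fs f0) a ⟩ monomialOf (child f (fs f0) a) M
  ≼-child₁ L M inj C≼ = dominated λ σ τ →
    ≤-trans (≤-at C≼ (fs f0 ∷ σ) (_ ∷ τ))
      (≤-reflexive (cong (_+ _) (monomialOf-other-child L σ τ inj (Finₚ.0≢1+n ∘ proj₁))))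

  Untouched : ∀ {j} → Mon → Address (suc j) → Fin r → Set
  Untouched C f a = ∀ σ τ → C (f σ (a ∷ τ)) ≡ 0

  untouched? : ∀ {j} C (f : Address (suc j)) a → Dec (Untouched C f a)
  untouched? {j} C f a = allWords? (suc j) (λ σ → allWords? j (λ τ → C (f σ (a ∷ τ)) ≟ 0))

  touched? : ∀ {j} C (f : Address (suc j)) → Dec (∃ λ a → ¬ Untouched C f a)
  touched? C f = Finₚ.any? (λ a → ¬? (untouched? C f a))

  forced-label : ∀ {j} {f : Address (suc j)} {b C} L M → Injective f →
    C ≼⟨ f ⟩ monomialOf f (node b L M) → ∀ a → ¬ Untouched C f a → b ≡ a
  forced-label {f = f} {b} {C} L M inj C≼ a touched with b Finₚ.≟ a
  ... | yes b≡a = b≡a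
  ... | no  b≢a = contradiction untouched touched
    where
    untouched : Untouched C f a
    untouched (_ ∷ σ) τ = n≤0⇒n≡0 (≤-trans (≤-at C≼ (_ ∷ σ) (a ∷ τ)) (≤-reflexive
      (cong₂ _+_ (monomialOf-other-child L σ τ inj (b≢a ∘ proj₂))
                 (monomialOf-other-child M σ τ inj (b≢a ∘ proj₂)))))

  untouched-everywhere : ∀ {j} C (f : Address (suc j)) → ¬ (∃ λ a → ¬ Untouched C f a) →
                         ∀ σ τ → C (f σ τ) ≡ 0
  untouched-everywhere C f none σ (a ∷ τ) with untouched? C f a
  ... | yes untouched = untouched σ τ
  ... | no  touched   = contradiction (a , touched) none

  untouched-∸m : ∀ {j} (f : Address j) L C → (∀ σ τ → C (f σ τ) ≡ 0) →
                 (monomialOf f L ∸m C) ≈m monomialOf f L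
  untouched-∸m f L C C≡0 x with monomialOf f L x ≟ 0
  ... | yes m≡0 = trans (cong (_∸ C x) m≡0) (trans (0∸n≡0 (C x)) (sym m≡0))
  ... | no  m≢0 with σ , τ , refl ← monomialOf-support f L m≢0 = cong (_ ∸_) (C≡0 σ τ)

  innerNodes : ℕ → ℕ
  innerNodes zero    = 0
  innerNodes (suc j) = suc (innerNodes j + innerNodes j)

  innerNodes<degMon : ∀ {j} (f : Address j) L → innerNodes j < degMon (monomialOf f L)
  innerNodes<degMon f leaf =
    ≤-trans (≤-reflexive (sym (varMon-self (f [] [])))) (≤-degMon _ (f [] []))
  innerNodes<degMon {suc j} f (node a L M) = begin
    suc (suc (innerNodes j + innerNodes j))
      ≡⟨ cong suc (+-suc _ _) ⟨
    suc (innerNodes j) + suc (innerNodes j)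
      ≤⟨ +-mono-≤ (innerNodes<degMon _ L) (innerNodes<degMon _ M) ⟩
    degMon (monomialOf _ L) + degMon (monomialOf _ M)
      ≡⟨ degMon-·m _ _ ⟨
    degMon (monomialOf f (node a L M)) ∎
    where open ≤-Reasoning

  nodes : ∀ {j} → List (Fin r) → List (Labelling j) → List (Labelling j) → List (Labelling (suc j))
  nodes as Ls Ms = cartesianProductWith (λ a → uncurry (node a)) as (cartesianProduct Ls Ms)

  ∈-nodes : ∀ {j} {as} {Ls Ms : List (Labelling j)} {a L M} →
            a ∈ as → L ∈ Ls → M ∈ Ms → node a L M ∈ nodes as Ls Ms
  ∈-nodes a∈ L∈ M∈ = ∈-cartesianProductWith⁺ _ a∈ (∈-cartesianProduct⁺ L∈ M∈)

  length-nodes : ∀ {j} as (Ls Ms : List (Labelling j)) →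
                 length (nodes as Ls Ms) ≡ length as * (length Ls * length Ms)
  length-nodes as Ls Ms =
    trans (length-cartesianProductWith _ as (cartesianProduct Ls Ms))
          (cong (length as *_) (length-cartesianProductWith _,_ Ls Ms))

  allLabellings : ∀ j → List (Labelling j)
  allLabellings zero    = leaf ∷ []
  allLabellings (suc j) = nodes (allFin r) (allLabellings j) (allLabellings j)

  ∈-allLabellings : ∀ {j} (L : Labelling j) → L ∈ allLabellings j
  ∈-allLabellings leaf         = here refl
  ∈-allLabellings (node a L M) = ∈-nodes (∈-allFin a) (∈-allLabellings L) (∈-allLabellings M)

  length-allLabellings : ∀ j → length (allLabellings j) ≡ r ^ innerNodes j
  length-allLabellings zero    = refl
  length-allLabellings (suc j) = begin
    length (nodes (allFin r) (allLabellings j) (allLabellings j))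
      ≡⟨ length-nodes (allFin r) (allLabellings j) (allLabellings j) ⟩
    length (allFin r) * (length (allLabellings j) * length (allLabellings j))
      ≡⟨ cong₂ (λ n l → n * (l * l)) (Listₚ.length-tabulate {n = r} id) (length-allLabellings j) ⟩
    r * (r ^ innerNodes j * r ^ innerNodes j)
      ≡⟨ cong (r *_) (sym (^-distribˡ-+-* r (innerNodes j) (innerNodes j))) ⟩
    r ^ innerNodes (suc j) ∎
    where open ≡-Reasoning

  -- Every labelling L with C ≼ mon(L) agrees, modulo C, with one in this list:
  -- a touched label is forced at the root, and below an untouched root
  -- mon(L) ∸ C is mon(L) itself.
  representatives : ∀ {j} → Mon → Address j → List (Labelling j)
  representatives {zero}  C f = leaf ∷ []
  representatives {suc j} C f with touched? C f
  ... | yes (a , _) =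
    nodes (a ∷ []) (representatives C (child f f0 a)) (representatives C (child f (fs f0) a))
  ... | no _        = allLabellings (suc j)

  representatives-complete : ∀ {j} {f : Address j} {C} L → Injective f → C ≼⟨ f ⟩ monomialOf f L →
    ∃ λ L′ → L′ ∈ representatives C f × (monomialOf f L ∸m C) ≈m (monomialOf f L′ ∸m C)
  representatives-complete leaf _ _ = leaf , here refl , ≈m-refl
  representatives-complete {f = f} {C} (node b L M) inj C≼ with touched? C f
  ... | no _ = node b L M , ∈-allLabellings (node b L M) , ≈m-refl
  ... | yes (a , touched) with refl ← forced-label L M inj C≼ a touched =
    let L′ , L′∈ , L≈L′ = representatives-complete L (child-injective inj) (≼-child₀ L M inj C≼)
        M′ , M′∈ , M≈M′ = representatives-complete M (child-injective inj) (≼-child₁ L M inj C≼)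
    in node a L′ M′ , ∈-nodes {as = a ∷ []} (here refl) L′∈ M′∈ ,
       ≈m-trans (node-∸m L M C inj) (≈m-trans (·m-cong L≈L′ M≈M′) (≈m-sym (node-∸m L′ M′ C inj)))

  length-representatives : ∀ .⦃ _ : NonZero r ⦄ {j} {f : Address j} {C} L → Injective f →
    C ≼⟨ f ⟩ monomialOf f L → length (representatives C f) ≤ r ^ (degMon (monomialOf f L ∸m C) ∸ 1)
  length-representatives {f = f} {C} leaf _ _ = m^n>0 r (degMon (monomialOf f leaf ∸m C) ∸ 1)
  length-representatives {suc j} {f} {C} (node b L M) inj C≼ with touched? C f
  ... | no none = begin
    length (allLabellings (suc j))
      ≡⟨ length-allLabellings (suc j) ⟩
    r ^ innerNodes (suc j)
      ≤⟨ ^-monoʳ-≤ r (∸-monoˡ-≤ 1 (innerNodes<degMon f (node b L M))) ⟩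
    r ^ (degMon (monomialOf f (node b L M)) ∸ 1)
      ≡⟨ cong (λ d → r ^ (d ∸ 1)) (degMon-cong (≈m-sym N∸C≈N)) ⟩
    r ^ (degMon (monomialOf f (node b L M) ∸m C) ∸ 1) ∎
    where
    open ≤-Reasoning
    N∸C≈N = untouched-∸m f (node b L M) C (untouched-everywhere C f none)
  ... | yes (a , touched) with refl ← forced-label L M inj C≼ a touched = begin
    length (nodes (a ∷ []) Ls Ms)
      ≡⟨ trans (length-nodes (a ∷ []) Ls Ms) (*-identityˡ _) ⟩
    length Ls * length Ms
      ≤⟨ *-mono-≤ (length-representatives L (child-injective inj) (≼-child₀ L M inj C≼))
                  (length-representatives M (child-injective inj) (≼-child₁ L M inj C≼)) ⟩
    r ^ (degMon L∸C ∸ 1) * r ^ (degMon M∸C ∸ 1)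
      ≤⟨ ^[m∸1]*^[n∸1]≤^[m+n∸1] r (degMon L∸C) (degMon M∸C) ⟩
    r ^ (degMon L∸C + degMon M∸C ∸ 1)
      ≡⟨ cong (λ d → r ^ (d ∸ 1))
              (trans (sym (degMon-·m L∸C M∸C)) (degMon-cong (≈m-sym (node-∸m L M C inj)))) ⟩
    r ^ (degMon (monomialOf f (node a L M) ∸m C) ∸ 1) ∎
    where
    open ≤-Reasoning
    Ls = representatives C (child f f0 a)
    Ms = representatives C (child f (fs f0) a)
    L∸C = monomialOf (child f f0 a) L ∸m C
    M∸C = monomialOf (child f (fs f0) a) M ∸m C

  quotients : Mon → List Mon
  quotients C = map (λ L → monomialOf address L ∸m C) (representatives C address)

  ∈-quotients : ∀ {C m} → (∃ λ L → monomialOf address L ≈m (m ·m C)) → Any (m ≈m_) (quotients C)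
  ∈-quotients {C} {m} (L , L≈mC) =
    let L′ , L′∈ , L≈L′ = representatives-complete L address-injective (divisor-≼ address m C L≈mC)
    in Anyₚ.map⁺ (lose L′∈ (≈m-trans (quotient-≈ m C L≈mC) L≈L′))

lemma4p3 : ∀ {c ℓ : Level} (𝔽 : Field c ℓ) (k r : ℕ) → 1 ≤ k → 2 ≤ r →
    let open Poly 𝔽 k r in
    (Φ : Formula) → IsFormula Φ → Monotone Φ → Φ computesSameAs H →
    (α : Formula) → α ⊑ Φ → (d : ℕ) → HasDegree α d →
    AtMostMonomials α (r ^ (d ∸ 1))
lemma4p3 𝔽 k r _ r≥2 Φ isF mono same α α⊑Φ d ((m₀ , m₀≉0 , deg-m₀) , _) ms distinct ms≉0
  with C , labelling ← GateMonomials.gate-labellings 𝔽 k r isF mono same α⊑Φ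
  with L₀ , L₀≈m₀C ← labelling m₀≉0 = begin
    length ms
      ≤⟨ Unique⇒length≤ Mon-setoid distinct (All.map (∈-quotients ∘ labelling) ms≉0) ⟩
    length (quotients C)
      ≡⟨ Listₚ.length-map _ (representatives C address) ⟩
    length (representatives C address)
      ≤⟨ length-representatives ⦃ >-nonZero r>0 ⦄ L₀ address-injective
                                (divisor-≼ address m₀ C L₀≈m₀C) ⟩
    r ^ (degMon (monomialOf address L₀ ∸m C) ∸ 1)
      ≡⟨ cong (λ e → r ^ (e ∸ 1)) (trans (degMon-cong (≈m-sym (quotient-≈ m₀ C L₀≈m₀C))) deg-m₀) ⟩
    r ^ (d ∸ 1) ∎
  where
  open Poly 𝔽 k r
  open GateMonomials 𝔽 k r
  open Setoid Mon-setoid using () renaming (sym to ≈m-sym)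
  open ≤-Reasoning
  r>0 : 0 < r
  r>0 = ≤-trans (s≤s z≤n) r≥2
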